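{- For every conditional relation $R$ we have $u(f_C(R))\subseteq f_C(R)$. Consequently $u(f_C(R))\subseteq f_C(u(R))$ for all conditional relations $R$, i.e. $u$ is $f_C$-compatible.
   Context: Composition of $f\colon A\to B$, $g\colon B\to C$ is written $f;g$. Fix a category $\mathbf C$ with distinguished object $0$ and a representative class $\kappa$ of commuting squares: for every commuting square $\alpha_1;\delta_1=\alpha_2;\delta_2$ there are $(\alpha_1,\alpha_2,\beta_1,\beta_2)\in\kappa$ (a commuting square) and $\gamma$ with $\delta_1=\beta_1;\gamma$, $\delta_2=\beta_2;\gamma$; $\kappa(\alpha_1,\alpha_2)$ is the set of $(\beta_1,\beta_2)$ with $(\alpha_1,\alpha_2,\beta_1,\beta_2)\in\kappa$. Conditions over $A$ are defined inductively as $(A,\mathcal Q,S)$, $\mathcal Q\in\{\forall,\exists\}$, $S$ a finite set of pairs $(h,\mathcal A')$ with $h\colon A\to A'$, $\mathcal A'$ a condition over $A'$. For $a\colon A\to B$: $a\models(A,\forall,S)$ iff for all $(h,\mathcal A')\in S$ and all $g$ with $a=h;g$, $g\models\mathcal A'$; $a\models(A,\exists,S)$ iff some $(h,\mathcal A')\in S$ and $g$ satisfy $a=h;g$, $g\models\mathcal A'$. $\mathcal A\models\mathcal B$: every arrow satisfying $\mathcal A$ satisfies $\mathcal B$. Boolean connectives have the standard semantics. Shift along $c\colon A\to B$: $(A,\mathcal Q,S)_{\downarrow c}=(B,\mathcal Q,\{(\beta,\mathcal A'_{\downarrow\alpha})\mid(h,\mathcal A')\in S,(\alpha,\beta)\in\kappa(h,c)\})$;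 it satisfies $c;d\models\mathcal A\iff d\models\mathcal A_{\downarrow c}$. A conditional reactive system is a set $\mathcal S$ of rules $(\ell,r,\mathcal R)$, $\ell,r\colon0\to I$, $\mathcal R$ a condition over $I$. Context step $a\xrightarrow[C]{f,\ \mathcal A}a'$ ($a\colon0\to J$, $f\colon J\to K$, $a'\colon0\to K$, $\mathcal A$ over $K$): there are a rule $(\ell,r,\mathcal R)\in\mathcal S$ and $c\colon I\to K$ with $a;f=\ell;c$, $a'=r;c$, $\mathcal A\models\mathcal R_{\downarrow c}$. A conditional relation is a set of triples $(a,b,\mathcal C)$, $a,b\colon0\to J$, $\mathcal C$ a condition over $J$. $\mathcal D\models\bigvee_{i\in I}\mathcal E_i$ (possibly infinite $I$): every arrow satisfying $\mathcal D$ satisfies some $\mathcal E_i$. The closure under contextualization is $u(R)=\{(a;d,\ b;d,\ \mathcal C_{\downarrow d})\mid(a,b,\mathcal C)\in R,\ a,b\colon0\to J,\ d\colon J\to K\}$. The function $f_C$ maps a conditional relation $R$ to the set of triples $(a,b,\mathcal C)$ such that for each context step $a\xrightarrow[C]{f,\ \mathcal A}a'$ there are an index set $I$, context steps $b\xrightarrow[C]{f,\ \mathcal B_i}b'_i$ and conditions $\mathcal C'_i$ with $(a',b'_i,\mathcal C'_i)\in R$ and $\mathcal A\land\mathcal C_{\downarrow f}\models\bigvee_{i\in I}(\mathcal C'_i\land\mathcal B_i)$, and symmetrically each context step $b\xrightarrow[C]{f,\ \mathcal B}b'$ is answered by context steps $a\xrightarrow[C]{f,\ \mathcal A_j}a'_j$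 with $(a'_j,b',\mathcal C'_j)\in R$ and $\mathcal B\land\mathcal C_{\downarrow f}\models\bigvee_j(\mathcal C'_j\land\mathcal A_j)$. -}

module Defs where

open import Level using (Level; _⊔_) renaming (suc to lsuc; zero to lzero)
open import Data.Product using (Σ; Σ-syntax; _×_; _,_)
open import Data.List using (List; []; _∷_; _++_)
open import Data.List.Membership.Propositional using (_∈_)
open import Data.Unit using (⊤)
open import Relation.Binary.PropositionalEquality using (_≡_)

-- A category (arrow equality is propositional equality), composition written
-- diagrammatically: f ⨾ g means "first f, then g" (the paper's f;g),
-- with a distinguished object 𝟎 and a representative class κ of commuting
-- squares.  κ α₁ α₂ is the set κ(α₁,α₂) of pairs (β₁,β₂) (with their common
-- codomain D); it is given as a finite list.
record RepCat : Set₁ where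
  infixl 9 _⨾_
  field
    Obj  : Set
    Hom  : Obj → Obj → Set
    _⨾_  : ∀ {A B C} → Hom A B → Hom B C → Hom A C
    id   : ∀ {A} → Hom A A
    assoc : ∀ {A B C D} (f : Hom A B) (g : Hom B C) (h : Hom C D) →
            (f ⨾ g) ⨾ h ≡ f ⨾ (g ⨾ h)
    idˡ  : ∀ {A B} (f : Hom A B) → id ⨾ f ≡ f
    idʳ  : ∀ {A B} (f : Hom A B) → f ⨾ id ≡ f
    𝟎    : Obj
    κ    : ∀ {A B C} → Hom A B → Hom A C → List (Σ[ D ∈ Obj ] (Hom B D × Hom C D))
    κ-comm : ∀ {A B C D} (α₁ : Hom A B) (α₂ : Hom A C) (β₁ : Hom B D) (β₂ : Hom C D) →
             (D , β₁ , β₂) ∈ κ α₁ α₂ → α₁ ⨾ β₁ ≡ α₂ ⨾ β₂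
    κ-rep : ∀ {A B C E} (α₁ : Hom A B) (α₂ : Hom A C) (δ₁ : Hom B E) (δ₂ : Hom C E) →
            α₁ ⨾ δ₁ ≡ α₂ ⨾ δ₂ →
            Σ[ D ∈ Obj ] Σ[ β₁ ∈ Hom B D ] Σ[ β₂ ∈ Hom C D ]
              ((D , β₁ , β₂) ∈ κ α₁ α₂ ×
               Σ[ γ ∈ Hom D E ] (δ₁ ≡ β₁ ⨾ γ × δ₂ ≡ β₂ ⨾ γ))

data Quant : Set where
  ∀Q ∃Q : Quant

module _ (𝒞 : RepCat) where
  open RepCat 𝒞

  -- Conditions over A: (A, Q, S) with S a finite set (list) of pairs (h, A')
  data Cond (A : Obj) : Set where
    cond : Quant → List (Σ[ A' ∈ Obj ] (Hom A A' × Cond A')) → Cond A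

  mutual
    sat : ∀ {A B} → Hom A B → Cond A → Set
    sat a (cond ∀Q S) = satAll a S
    sat a (cond ∃Q S) = satAny a S

    satAll : ∀ {A B} → Hom A B → List (Σ[ A' ∈ Obj ] (Hom A A' × Cond A')) → Set
    satAll a [] = ⊤
    satAll {B = B} a ((A' , h , 𝒜') ∷ S) =
      ((g : Hom A' B) → a ≡ h ⨾ g → sat g 𝒜') × satAll a S

    satAny : ∀ {A B} → Hom A B → List (Σ[ A' ∈ Obj ] (Hom A A' × Cond A')) → Set
    satAny a [] = Data.Empty.⊥
      where import Data.Empty
    satAny {B = B} a ((A' , h , 𝒜') ∷ S) =
      (Σ[ g ∈ Hom A' B ] (a ≡ h ⨾ g × sat g 𝒜')) Data.Sum.⊎ satAny a S
      where import Data.Sum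

  _⊨_ : ∀ {A} → Cond A → Cond A → Set
  _⊨_ {A} 𝒜 ℬ = ∀ {B} (a : Hom A B) → sat a 𝒜 → sat a ℬ

  mutual
    shift : ∀ {A B} → Cond A → Hom A B → Cond B
    shift (cond Q S) c = cond Q (shiftList S c)

    shiftList : ∀ {A B} → List (Σ[ A' ∈ Obj ] (Hom A A' × Cond A')) → Hom A B →
                List (Σ[ B' ∈ Obj ] (Hom B B' × Cond B'))
    shiftList [] c = []
    shiftList ((A' , h , 𝒜') ∷ S) c = shiftK 𝒜' (κ h c) ++ shiftList S c

    shiftK : ∀ {A' B} → Cond A' → List (Σ[ D ∈ Obj ] (Hom A' D × Hom B D)) →
             List (Σ[ D ∈ Obj ] (Hom B D × Cond D))
    shiftK 𝒜' [] = []
    shiftK 𝒜' ((D , α , β) ∷ ks) = (D , β , shift 𝒜' α) ∷ shiftK 𝒜' ks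

  data BCond (A : Obj) : Set₁ where
    atom : Cond A → BCond A
    _∧_  : BCond A → BCond A → BCond A
    ⋁    : (I : Set) → (I → BCond A) → BCond A

  satB : ∀ {A B} → Hom A B → BCond A → Set
  satB a (atom 𝒜) = sat a 𝒜
  satB a (𝒟 ∧ ℰ) = satB a 𝒟 × satB a ℰ
  satB a (⋁ I ℰ) = Σ[ i ∈ I ] satB a (ℰ i)

  _⊨B_ : ∀ {A} → BCond A → BCond A → Set
  _⊨B_ {A} 𝒟 ℰ = ∀ {B} (a : Hom A B) → satB a 𝒟 → satB a ℰ

  record ReactiveSystem : Set₁ where
    field
      Rule : (I : Obj) → Hom 𝟎 I → Hom 𝟎 I → Cond I → Set

  CondRel : (ℓ : Level) → Set (lsuc ℓ)
  CondRel ℓ = (J : Obj) → Hom 𝟎 J → Hom 𝟎 J → Cond J → Set ℓ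

  _⊆_ : ∀ {ℓ₁ ℓ₂} → CondRel ℓ₁ → CondRel ℓ₂ → Set (ℓ₁ ⊔ ℓ₂)
  R ⊆ R' = ∀ {J a b 𝒞} → R J a b 𝒞 → R' J a b 𝒞

  u : ∀ {ℓ} → CondRel ℓ → CondRel ℓ
  u R K a' b' 𝒞' =
    Σ[ J ∈ Obj ] Σ[ a ∈ Hom 𝟎 J ] Σ[ b ∈ Hom 𝟎 J ] Σ[ 𝒞 ∈ Cond J ] Σ[ d ∈ Hom J K ]
      (R J a b 𝒞 × a' ≡ a ⨾ d × b' ≡ b ⨾ d × 𝒞' ≡ shift 𝒞 d)

  module _ (𝒮 : ReactiveSystem) where
    open ReactiveSystem 𝒮

    CStep : ∀ {J K} → Hom 𝟎 J → Hom J K → Cond K → Hom 𝟎 K → Set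
    CStep {J} {K} a f 𝒜 a' =
      Σ[ I ∈ Obj ] Σ[ l ∈ Hom 𝟎 I ] Σ[ r ∈ Hom 𝟎 I ] Σ[ ℛ ∈ Cond I ] Σ[ c ∈ Hom I K ]
        (Rule I l r ℛ × a ⨾ f ≡ l ⨾ c × a' ≡ r ⨾ c × 𝒜 ⊨ shift ℛ c)

    fC : ∀ {ℓ} → CondRel ℓ → CondRel (lsuc lzero ⊔ ℓ)
    fC R J a b 𝒞 =
      (∀ {K} (f : Hom J K) (𝒜 : Cond K) (a' : Hom 𝟎 K) → CStep a f 𝒜 a' →
        Σ[ I ∈ Set ] Σ[ b' ∈ (I → Hom 𝟎 K) ] Σ[ ℬ ∈ (I → Cond K) ] Σ[ 𝒞' ∈ (I → Cond K) ]
          ((∀ i → CStep b f (ℬ i) (b' i)) ×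
           (∀ i → R K a' (b' i) (𝒞' i)) ×
           ((atom 𝒜 ∧ atom (shift 𝒞 f)) ⊨B ⋁ I (λ i → atom (𝒞' i) ∧ atom (ℬ i)))))
      ×
      (∀ {K} (f : Hom J K) (ℬ : Cond K) (b' : Hom 𝟎 K) → CStep b f ℬ b' →
        Σ[ I ∈ Set ] Σ[ a' ∈ (I → Hom 𝟎 K) ] Σ[ 𝒜 ∈ (I → Cond K) ] Σ[ 𝒞' ∈ (I → Cond K) ]
          ((∀ j → CStep a f (𝒜 j) (a' j)) ×
           (∀ j → R K (a' j) b' (𝒞' j)) ×
           ((atom ℬ ∧ atom (shift 𝒞 f)) ⊨B ⋁ I (λ j → atom (𝒞' j) ∧ atom (𝒜 j)))))

-- The proof has three layers.
--  * Shift lemma: c ⨾ d ⊨ 𝒜  iff  d ⊨ 𝒜↓c, proved by mutual induction on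
--    conditions.  The only categorical input is that κ-squares commute and
--    that every commuting square factors through one in κ.  It yields the
--    entailments C↓d↓f ⊨ C↓(d ⨾ f) and C ⊨ C↓id.
--  * f_C R is, definitionally, the conjunction of a forward simulation
--    condition for R and the forward condition for the transposed relation
--    with the two arrows swapped.  Every property is therefore proved once,
--    for one direction ('Simulates').
--  * Two facts about 'Simulates': it is stable under placing both arrows into
--    a context d (a step of a ⨾ d under f is a step of a under d ⨾ f), and it
--    is monotone in R for the preorder "every triple of R is matched by a
--    triple of R' with a weaker condition" ('_⊑_').
-- The theorem follows: u (f_C R) ⊆ f_C R by context stability, and since
-- R ⊑ u R (take d = id), monotonicity gives f_C R ⊆ f_C (u R).
module Submission where

open import Defs
open import Level using (Level; _⊔_) renaming (suc to lsuc; zero to lzero)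
open import Data.Product using (_×_; Σ-syntax; _,_; proj₁; proj₂)
open import Data.List using (List; []; _∷_; _++_)
open import Data.List.Membership.Propositional using (_∈_)
open import Data.List.Relation.Unary.Any using (here; there)
open import Data.Sum using (_⊎_; inj₁; inj₂)
open import Data.Unit using (tt)
open import Relation.Binary.PropositionalEquality
  using (_≡_; refl; sym; trans; cong; subst; module ≡-Reasoning)

module _ (𝒞 : RepCat) where
  open RepCat 𝒞

  Entry : Obj → Set
  Entry A = Σ[ A' ∈ Obj ] (Hom A A' × Cond 𝒞 A')

  Squares : Obj → Obj → Set
  Squares B C = Σ[ D ∈ Obj ] (Hom B D × Hom C D)

  satAll-++ : ∀ {A B} {d : Hom A B} (xs ys : List (Entry A)) →
    satAll 𝒞 d xs → satAll 𝒞 d ys → satAll 𝒞 d (xs ++ ys)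
  satAll-++ []       ys _        q = q
  satAll-++ (x ∷ xs) ys (p , ps) q = p , satAll-++ xs ys ps q

  satAll-++ˡ : ∀ {A B} {d : Hom A B} (xs ys : List (Entry A)) →
    satAll 𝒞 d (xs ++ ys) → satAll 𝒞 d xs
  satAll-++ˡ []       ys _        = tt
  satAll-++ˡ (x ∷ xs) ys (p , ps) = p , satAll-++ˡ xs ys ps

  satAll-++ʳ : ∀ {A B} {d : Hom A B} (xs ys : List (Entry A)) →
    satAll 𝒞 d (xs ++ ys) → satAll 𝒞 d ys
  satAll-++ʳ []       ys q        = q
  satAll-++ʳ (x ∷ xs) ys (_ , ps) = satAll-++ʳ xs ys ps

  satAny-++ˡ : ∀ {A B} {d : Hom A B} (xs ys : List (Entry A)) →
    satAny 𝒞 d xs → satAny 𝒞 d (xs ++ ys)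
  satAny-++ˡ (x ∷ xs) ys (inj₁ p) = inj₁ p
  satAny-++ˡ (x ∷ xs) ys (inj₂ p) = inj₂ (satAny-++ˡ xs ys p)

  satAny-++ʳ : ∀ {A B} {d : Hom A B} (xs ys : List (Entry A)) →
    satAny 𝒞 d ys → satAny 𝒞 d (xs ++ ys)
  satAny-++ʳ []       ys p = p
  satAny-++ʳ (x ∷ xs) ys p = inj₂ (satAny-++ʳ xs ys p)

  satAny-++⁻ : ∀ {A B} {d : Hom A B} (xs ys : List (Entry A)) →
    satAny 𝒞 d (xs ++ ys) → satAny 𝒞 d xs ⊎ satAny 𝒞 d ys
  satAny-++⁻ []       ys p        = inj₂ p
  satAny-++⁻ (x ∷ xs) ys (inj₁ p) = inj₁ (inj₁ p)
  satAny-++⁻ (x ∷ xs) ys (inj₂ p) with satAny-++⁻ xs ys p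
  ... | inj₁ q = inj₁ (inj₂ q)
  ... | inj₂ q = inj₂ q

  satAll-shiftK-intro : ∀ {A' B E} (𝒜' : Cond 𝒞 A') {d : Hom B E} (ks : List (Squares A' B)) →
    (∀ {D α β} → (D , α , β) ∈ ks → ∀ g → d ≡ β ⨾ g → sat 𝒞 g (shift 𝒞 𝒜' α)) →
    satAll 𝒞 d (shiftK 𝒞 𝒜' ks)
  satAll-shiftK-intro 𝒜' []       P = tt
  satAll-shiftK-intro 𝒜' (k ∷ ks) P =
    P (here refl) , satAll-shiftK-intro 𝒜' ks (λ m → P (there m))

  satAll-shiftK-elim : ∀ {A' B E D} (𝒜' : Cond 𝒞 A') {d : Hom B E} (ks : List (Squares A' B))
    {α : Hom A' D} {β : Hom B D} → satAll 𝒞 d (shiftK 𝒞 𝒜' ks) → (D , α , β) ∈ ks →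
    ∀ g → d ≡ β ⨾ g → sat 𝒞 g (shift 𝒞 𝒜' α)
  satAll-shiftK-elim 𝒜' (k ∷ ks) (p , _)  (here refl) = p
  satAll-shiftK-elim 𝒜' (k ∷ ks) (_ , ps) (there m)   = satAll-shiftK-elim 𝒜' ks ps m

  satAny-shiftK-intro : ∀ {A' B E D} (𝒜' : Cond 𝒞 A') {d : Hom B E} (ks : List (Squares A' B))
    {α : Hom A' D} {β : Hom B D} → (D , α , β) ∈ ks →
    (g : Hom D E) → d ≡ β ⨾ g → sat 𝒞 g (shift 𝒞 𝒜' α) → satAny 𝒞 d (shiftK 𝒞 𝒜' ks)
  satAny-shiftK-intro 𝒜' (k ∷ ks) (here refl) g e s = inj₁ (g , e , s)
  satAny-shiftK-intro 𝒜' (k ∷ ks) (there m)   g e s = inj₂ (satAny-shiftK-intro 𝒜' ks m g e s)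

  satAny-shiftK-elim : ∀ {A' B E} (𝒜' : Cond 𝒞 A') {d : Hom B E} (ks : List (Squares A' B)) →
    satAny 𝒞 d (shiftK 𝒞 𝒜' ks) →
    Σ[ D ∈ Obj ] Σ[ α ∈ Hom A' D ] Σ[ β ∈ Hom B D ] Σ[ g ∈ Hom D E ]
      ((D , α , β) ∈ ks × d ≡ β ⨾ g × sat 𝒞 g (shift 𝒞 𝒜' α))
  satAny-shiftK-elim 𝒜' ((D , α , β) ∷ ks) (inj₁ (g , e , s)) = D , α , β , g , here refl , e , s
  satAny-shiftK-elim 𝒜' (k ∷ ks) (inj₂ p) with satAny-shiftK-elim 𝒜' ks p
  ... | D , α , β , g , m , e , s = D , α , β , g , there m , e , s

  paste-square : ∀ {A A' B D E} (h : Hom A A') (c : Hom A B) (α : Hom A' D) (β : Hom B D)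
    {d : Hom B E} (g : Hom D E) → h ⨾ α ≡ c ⨾ β → d ≡ β ⨾ g → c ⨾ d ≡ h ⨾ (α ⨾ g)
  paste-square h c α β {d} g square d≡β⨾g = begin
    c ⨾ d        ≡⟨ cong (c ⨾_) d≡β⨾g ⟩
    c ⨾ (β ⨾ g)  ≡⟨ sym (assoc c β g) ⟩
    (c ⨾ β) ⨾ g  ≡⟨ cong (_⨾ g) (sym square) ⟩
    (h ⨾ α) ⨾ g  ≡⟨ assoc h α g ⟩
    h ⨾ (α ⨾ g)  ∎
    where open ≡-Reasoning

  mutual
    shift-sound : ∀ {A B E} (𝒜 : Cond 𝒞 A) (c : Hom A B) (d : Hom B E) →
      sat 𝒞 (c ⨾ d) 𝒜 → sat 𝒞 d (shift 𝒞 𝒜 c)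
    shift-sound (cond ∀Q S) c d = shift-sound-all S c d
    shift-sound (cond ∃Q S) c d = shift-sound-any S c d

    shift-complete : ∀ {A B E} (𝒜 : Cond 𝒞 A) (c : Hom A B) (d : Hom B E) →
      sat 𝒞 d (shift 𝒞 𝒜 c) → sat 𝒞 (c ⨾ d) 𝒜
    shift-complete (cond ∀Q S) c d = shift-complete-all S c d
    shift-complete (cond ∃Q S) c d = shift-complete-any S c d

    -- Each κ-square (α, β) of (h, c) turns a factorisation d = β ⨾ g into
    -- the factorisation c ⨾ d = h ⨾ (α ⨾ g).
    shift-sound-all : ∀ {A B E} (S : List (Entry A)) (c : Hom A B) (d : Hom B E) →
      satAll 𝒞 (c ⨾ d) S → satAll 𝒞 d (shiftList 𝒞 S c)
    shift-sound-all [] c d _ = tt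
    shift-sound-all ((A' , h , 𝒜') ∷ S) c d (P , Q) =
      satAll-++ (shiftK 𝒞 𝒜' (κ h c)) (shiftList 𝒞 S c)
        (satAll-shiftK-intro 𝒜' (κ h c) λ {_} {α} {β} m g d≡β⨾g →
          shift-sound 𝒜' α g (P (α ⨾ g) (paste-square h c α β g (κ-comm h c α β m) d≡β⨾g)))
        (shift-sound-all S c d Q)

    -- Conversely, a factorisation c ⨾ d = h ⨾ g factors through a κ-square.
    shift-complete-all : ∀ {A B E} (S : List (Entry A)) (c : Hom A B) (d : Hom B E) →
      satAll 𝒞 d (shiftList 𝒞 S c) → satAll 𝒞 (c ⨾ d) S
    shift-complete-all [] c d _ = tt
    shift-complete-all ((A' , h , 𝒜') ∷ S) c d H =
      (λ g c⨾d≡h⨾g → entry g c⨾d≡h⨾g) ,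
      shift-complete-all S c d (satAll-++ʳ (shiftK 𝒞 𝒜' (κ h c)) (shiftList 𝒞 S c) H)
      where
      entry : ∀ g → c ⨾ d ≡ h ⨾ g → sat 𝒞 g 𝒜'
      entry g c⨾d≡h⨾g with κ-rep h c g d (sym c⨾d≡h⨾g)
      ... | _ , β₁ , _ , m , γ , g≡β₁⨾γ , d≡β₂⨾γ =
        subst (λ x → sat 𝒞 x 𝒜') (sym g≡β₁⨾γ)
          (shift-complete 𝒜' β₁ γ
            (satAll-shiftK-elim 𝒜' (κ h c)
              (satAll-++ˡ (shiftK 𝒞 𝒜' (κ h c)) (shiftList 𝒞 S c) H) m γ d≡β₂⨾γ))

    shift-sound-any : ∀ {A B E} (S : List (Entry A)) (c : Hom A B) (d : Hom B E) →
      satAny 𝒞 (c ⨾ d) S → satAny 𝒞 d (shiftList 𝒞 S c)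
    shift-sound-any ((A' , h , 𝒜') ∷ S) c d (inj₁ (g , c⨾d≡h⨾g , s))
      with κ-rep h c g d (sym c⨾d≡h⨾g)
    ... | _ , β₁ , _ , m , γ , g≡β₁⨾γ , d≡β₂⨾γ =
      satAny-++ˡ (shiftK 𝒞 𝒜' (κ h c)) (shiftList 𝒞 S c)
        (satAny-shiftK-intro 𝒜' (κ h c) m γ d≡β₂⨾γ
          (shift-sound 𝒜' β₁ γ (subst (λ x → sat 𝒞 x 𝒜') g≡β₁⨾γ s)))
    shift-sound-any ((A' , h , 𝒜') ∷ S) c d (inj₂ p) =
      satAny-++ʳ (shiftK 𝒞 𝒜' (κ h c)) (shiftList 𝒞 S c) (shift-sound-any S c d p)

    shift-complete-any : ∀ {A B E} (S : List (Entry A)) (c : Hom A B) (d : Hom B E) →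
      satAny 𝒞 d (shiftList 𝒞 S c) → satAny 𝒞 (c ⨾ d) S
    shift-complete-any ((A' , h , 𝒜') ∷ S) c d p
      with satAny-++⁻ (shiftK 𝒞 𝒜' (κ h c)) (shiftList 𝒞 S c) p
    ... | inj₂ q = inj₂ (shift-complete-any S c d q)
    ... | inj₁ q with satAny-shiftK-elim 𝒜' (κ h c) q
    ...   | _ , α , β , g , m , d≡β⨾g , s =
      inj₁ (α ⨾ g , paste-square h c α β g (κ-comm h c α β m) d≡β⨾g , shift-complete 𝒜' α g s)

  shift-⨾ : ∀ {J K L} (C : Cond 𝒞 J) (d : Hom J K) (f : Hom K L) →
    _⊨_ 𝒞 (shift 𝒞 (shift 𝒞 C d) f) (shift 𝒞 C (d ⨾ f))
  shift-⨾ C d f x s =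
    shift-sound C (d ⨾ f) x
      (subst (λ y → sat 𝒞 y C) (sym (assoc d f x))
        (shift-complete C d (f ⨾ x) (shift-complete (shift 𝒞 C d) f x s)))

  shift-id : ∀ {K} (C : Cond 𝒞 K) → _⊨_ 𝒞 C (shift 𝒞 C id)
  shift-id C x s = shift-sound C id x (subst (λ y → sat 𝒞 y C) (sym (idˡ x)) s)

  transpose : ∀ {ℓ} → CondRel 𝒞 ℓ → CondRel 𝒞 ℓ
  transpose R K a b C = R K b a C

  _⊑_ : ∀ {ℓ₁ ℓ₂} → CondRel 𝒞 ℓ₁ → CondRel 𝒞 ℓ₂ → Set (ℓ₁ ⊔ ℓ₂)
  R ⊑ R' = ∀ {J a b C} → R J a b C → Σ[ C' ∈ Cond 𝒞 J ] (R' J a b C' × _⊨_ 𝒞 C C')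

  ⊑-u : ∀ {ℓ} (R : CondRel 𝒞 ℓ) → R ⊑ u 𝒞 R
  ⊑-u R {J} {a} {b} {C} r =
    shift 𝒞 C id , (J , a , b , C , id , r , sym (idʳ a) , sym (idʳ b) , refl) , shift-id C

  module _ (𝒮 : ReactiveSystem 𝒞) where

    step-out-of-context : ∀ {J K L} {a : Hom 𝟎 J} {d : Hom J K} {f : Hom K L} {𝒜 a'} →
      CStep 𝒞 𝒮 (a ⨾ d) f 𝒜 a' → CStep 𝒞 𝒮 a (d ⨾ f) 𝒜 a'
    step-out-of-context {a = a} {d} {f} (I , l , r , ℛ , c , rule , a⨾d⨾f≡l⨾c , rest) =
      I , l , r , ℛ , c , rule , trans (sym (assoc a d f)) a⨾d⨾f≡l⨾c , rest

    step-into-context : ∀ {J K L} {a : Hom 𝟎 J} {d : Hom J K} {f : Hom K L} {𝒜 a'} →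
      CStep 𝒞 𝒮 a (d ⨾ f) 𝒜 a' → CStep 𝒞 𝒮 (a ⨾ d) f 𝒜 a'
    step-into-context {a = a} {d} {f} (I , l , r , ℛ , c , rule , a⨾d⨾f≡l⨾c , rest) =
      I , l , r , ℛ , c , rule , trans (assoc a d f) a⨾d⨾f≡l⨾c , rest

    -- One half of f_C; by definition  f_C R J a b C  is
    --   Simulates R J a b C × Simulates (transpose R) J b a C.
    Simulates : ∀ {ℓ} → CondRel 𝒞 ℓ → CondRel 𝒞 (lsuc lzero ⊔ ℓ)
    Simulates R J a b C =
      ∀ {K} (f : Hom J K) (𝒜 : Cond 𝒞 K) (a' : Hom 𝟎 K) → CStep 𝒞 𝒮 a f 𝒜 a' →
        Σ[ I ∈ Set ] Σ[ b' ∈ (I → Hom 𝟎 K) ] Σ[ ℬ ∈ (I → Cond 𝒞 K) ] Σ[ C' ∈ (I → Cond 𝒞 K) ]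
          ((∀ i → CStep 𝒞 𝒮 b f (ℬ i) (b' i)) ×
           (∀ i → R K a' (b' i) (C' i)) ×
           _⊨B_ 𝒞 (atom 𝒜 ∧ atom (shift 𝒞 C f)) (⋁ I (λ i → atom (C' i) ∧ atom (ℬ i))))

    -- Simulation is preserved when both arrows are placed into a context d:
    -- answer a step of a ⨾ d under f by the answer to a's step under d ⨾ f.
    simulates-context : ∀ {ℓ} (R : CondRel 𝒞 ℓ) {J K a b C} (d : Hom J K) →
      Simulates R J a b C → Simulates R K (a ⨾ d) (b ⨾ d) (shift 𝒞 C d)
    simulates-context R {a = a} {b} {C} d sim f 𝒜 a' step
      with sim (d ⨾ f) 𝒜 a' (step-out-of-context {a = a} {d} {f} {𝒜} {a'} step)
    ... | I , b' , ℬ , C' , steps , related , entails =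
      I , b' , ℬ , C' , (λ i → step-into-context {a = b} {d} {f} {ℬ i} {b' i} (steps i)) ,
      related ,
      λ x (s𝒜 , sC) → entails x (s𝒜 , shift-⨾ C d f x sC)

    simulates-mono : ∀ {ℓ₁ ℓ₂} {R : CondRel 𝒞 ℓ₁} {R' : CondRel 𝒞 ℓ₂} → R ⊑ R' →
      ∀ {J a b C} → Simulates R J a b C → Simulates R' J a b C
    simulates-mono R⊑R' sim f 𝒜 a' step with sim f 𝒜 a' step
    ... | I , b' , ℬ , C' , steps , related , entails =
      I , b' , ℬ , (λ i → proj₁ (R⊑R' (related i))) , steps ,
      (λ i → proj₁ (proj₂ (R⊑R' (related i)))) ,
      λ x s → weaken x (entails x s)
      where
      weaken : ∀ {M} (x : Hom _ M) → satB 𝒞 x (⋁ I (λ i → atom (C' i) ∧ atom (ℬ i))) →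
        satB 𝒞 x (⋁ I (λ i → atom (proj₁ (R⊑R' (related i))) ∧ atom (ℬ i)))
      weaken x (i , sC' , sℬ) = i , proj₂ (proj₂ (R⊑R' (related i))) x sC' , sℬ

    fC-context-closed : ∀ {ℓ} (R : CondRel 𝒞 ℓ) → _⊆_ 𝒞 (u 𝒞 (fC 𝒞 𝒮 R)) (fC 𝒞 𝒮 R)
    fC-context-closed R (_ , a , b , C , d , (forth , back) , refl , refl , refl) =
      simulates-context R {a = a} {b} {C} d forth ,
      simulates-context (transpose R) {a = b} {a} {C} d back

    -- f_C is monotone along ⊑; for the backward half note that
    -- transpose R ⊑ transpose R' unfolds to R ⊑ R' with a and b swapped.
    fC-mono : ∀ {ℓ₁ ℓ₂} {R : CondRel 𝒞 ℓ₁} {R' : CondRel 𝒞 ℓ₂} → R ⊑ R' →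
      _⊆_ 𝒞 (fC 𝒞 𝒮 R) (fC 𝒞 𝒮 R')
    fC-mono {R = R} {R'} R⊑R' {J} {a} {b} {C} (forth , back) =
      simulates-mono {R = R} {R'} R⊑R' {J} {a} {b} {C} forth ,
      simulates-mono {R = transpose R} {transpose R'} (λ r → R⊑R' r) {J} {b} {a} {C} back

theorem5p9 : (𝒞 : RepCat) (𝒮 : ReactiveSystem 𝒞) {ℓ : Level} (R : CondRel 𝒞 ℓ) →
    _⊆_ 𝒞 (u 𝒞 (fC 𝒞 𝒮 R)) (fC 𝒞 𝒮 R) × _⊆_ 𝒞 (u 𝒞 (fC 𝒞 𝒮 R)) (fC 𝒞 𝒮 (u 𝒞 R))
theorem5p9 𝒞 𝒮 R =
  fC-context-closed 𝒞 𝒮 R ,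
  λ {J} {a} {b} {C} p →
    fC-mono 𝒞 𝒮 {R = R} {u 𝒞 R} (⊑-u 𝒞 R) {J} {a} {b} {C} (fC-context-closed 𝒞 𝒮 R p)
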